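{- Let $\Gamma,\Delta$ be finite multisets of formulas. If $\mathsf{K}^+\vdash\bigwedge\Gamma\to\bigvee\Delta$, then the sequent $\Gamma\Rightarrow\Delta$ is provable by a regular $\infty$-proof in the calculus $\mathsf{S}$.
   Context: Formulas are built from propositional variables $p_0,p_1,\dots$ and $\bot$ by $\to$, $\Box$, $\Box^+$; $\neg A:=A\to\bot$, $\top:=\neg\bot$, $A\wedge B:=\neg(A\to\neg B)$, $A\vee B:=\neg A\to B$. The logic $\mathsf{K}^+$ is axiomatized by: $A\to(B\to A)$; $(A\to(B\to C))\to((A\to B)\to(A\to C))$; $\neg\neg A\to A$; $\Box(A\to B)\to(\Box A\to\Box B)$; $\Box^+(A\to B)\to(\Box^+A\to\Box^+B)$; $\Box^+A\to\Box A$; $\Box^+A\to\Box\Box^+A$; $\Box A\wedge\Box^+(A\to\Box A)\to\Box^+A$; rules modus ponens and necessitation (from $A$ infer $\Box^+A$). A sequent is $\Gamma\Rightarrow\Delta$ with $\Gamma,\Delta$ finite multisets; commas denote multiset union, $\Box\Gamma$, $\Box^+\Gamma$ apply the connective to each member. The calculus $\mathsf{S}$ has rules: axioms $\Gamma,p\Rightarrow p,\Delta$ ($p$ a variable) and $\Gamma,\bot\Rightarrow\Delta$; $(\to_L)$: from $\Gamma,B\Rightarrow\Delta$ and $\Gamma\Rightarrow A,\Delta$ infer $\Gamma,A\to B\Rightarrow\Delta$; $(\to_R)$: from $\Gamma,A\Rightarrow B,\Delta$ infer $\Gamma\Rightarrow A\to B,\Delta$; $(\Box)$: from $\Sigma,\Pi,\Box^+\Pi\Rightarrow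 A$ infer $\Upsilon,\Box\Sigma,\Box^+\Pi\Rightarrow\Box A,\Lambda$; $(\Box^+)$: from left premise $\Sigma,\Pi,\Box^+\Pi\Rightarrow A$ and right premise $\Sigma,\Pi,\Box^+\Pi\Rightarrow\Box^+A$ infer $\Upsilon,\Box\Sigma,\Box^+\Pi\Rightarrow\Box^+A,\Lambda$ (principal formulas $\Box A$, $\Box^+A$). An $\infty$-proof is a possibly infinite tree of sequents built according to these rules (leaves are axioms) such that every infinite branch has a tail in which all $(\Box^+)$-applications have the same principal formula, which passes through the right premise of $(\Box^+)$ infinitely often, never through the left premise of $(\Box^+)$, and contains no $(\Box)$-application. It is regular if it has only finitely many pairwise non-isomorphic subtrees (as sequent-labelled trees). -}

module Defs where

open import Data.Nat using (ℕ; zero; suc; _≤_)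
open import Data.Fin using (Fin; zero; suc)
open import Data.List using (List; []; _∷_; _++_; map; length)
open import Data.List.Relation.Binary.Permutation.Propositional using (_↭_)
open import Data.Product using (Σ; ∃; _×_; _,_)
open import Relation.Binary.PropositionalEquality using (_≡_)
open import Relation.Nullary using (¬_)

infixr 5 _⇒_

data Fm : Set where
  var  : ℕ → Fm
  ⊥'   : Fm
  _⇒_  : Fm → Fm → Fm
  □    : Fm → Fm
  □⁺   : Fm → Fm

¬' : Fm → Fm
¬' A = A ⇒ ⊥'

⊤' : Fm
⊤' = ¬' ⊥'

_∧'_ : Fm → Fm → Fm
A ∧' B = ¬' (A ⇒ ¬' B)

_∨'_ : Fm → Fm → Fm
A ∨' B = ¬' A ⇒ B

⋀ : List Fm → Fm
⋀ []      = ⊤'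
⋀ (A ∷ Γ) = A ∧' ⋀ Γ

⋁ : List Fm → Fm
⋁ []      = ⊥'
⋁ (A ∷ Δ) = A ∨' ⋁ Δ

data K⁺⊢_ : Fm → Set where
  ax1   : ∀ {A B} → K⁺⊢ (A ⇒ (B ⇒ A))
  ax2   : ∀ {A B C} → K⁺⊢ ((A ⇒ (B ⇒ C)) ⇒ ((A ⇒ B) ⇒ (A ⇒ C)))
  ax3   : ∀ {A} → K⁺⊢ (¬' (¬' A) ⇒ A)
  kBox  : ∀ {A B} → K⁺⊢ (□ (A ⇒ B) ⇒ (□ A ⇒ □ B))
  kBox⁺ : ∀ {A B} → K⁺⊢ (□⁺ (A ⇒ B) ⇒ (□⁺ A ⇒ □⁺ B))
  ax⁺1  : ∀ {A} → K⁺⊢ (□⁺ A ⇒ □ A)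
  ax⁺2  : ∀ {A} → K⁺⊢ (□⁺ A ⇒ □ (□⁺ A))
  ind   : ∀ {A} → K⁺⊢ ((□ A ∧' □⁺ (A ⇒ □ A)) ⇒ □⁺ A)
  mp    : ∀ {A B} → K⁺⊢ (A ⇒ B) → K⁺⊢ A → K⁺⊢ B
  nec   : ∀ {A} → K⁺⊢ A → K⁺⊢ (□⁺ A)

-- Sequents Γ ⇒ Δ; multisets are represented by lists, compared up to
-- permutation (_↭_).

record Sequent : Set where
  constructor _⊢_
  field
    ant : List Fm
    suc' : List Fm

open Sequent

_≅_ : Sequent → Sequent → Set
S ≅ T = (ant S ↭ ant T) × (suc' S ↭ suc' T)

-- For (□⁺) the
-- premise with index 0 is the left premise and index 1 the right one.
data Inst : Sequent → List Sequent → Set where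
  axVar : ∀ Γ Δ n → Inst ((var n ∷ Γ) ⊢ (var n ∷ Δ)) []
  ax⊥   : ∀ Γ Δ → Inst ((⊥' ∷ Γ) ⊢ Δ) []
  ⇒L    : ∀ Γ Δ A B →
          Inst (((A ⇒ B) ∷ Γ) ⊢ Δ) (((B ∷ Γ) ⊢ Δ) ∷ (Γ ⊢ (A ∷ Δ)) ∷ [])
  ⇒R    : ∀ Γ Δ A B →
          Inst (Γ ⊢ ((A ⇒ B) ∷ Δ)) (((A ∷ Γ) ⊢ (B ∷ Δ)) ∷ [])
  boxR  : ∀ Υ Σ' Π Λ A →
          Inst ((Υ ++ map □ Σ' ++ map □⁺ Π) ⊢ (□ A ∷ Λ))
               (((Σ' ++ Π ++ map □⁺ Π) ⊢ (A ∷ [])) ∷ [])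
  box⁺R : ∀ Υ Σ' Π Λ A →
          Inst ((Υ ++ map □ Σ' ++ map □⁺ Π) ⊢ (□⁺ A ∷ Λ))
               (((Σ' ++ Π ++ map □⁺ Π) ⊢ (A ∷ []))
                ∷ ((Σ' ++ Π ++ map □⁺ Π) ⊢ (□⁺ A ∷ [])) ∷ [])

record Node (N : ℕ) (lab : Fin N → Sequent) (S : Sequent) : Set where
  field
    concl    : Sequent
    prems    : List Sequent
    inst     : Inst concl prems
    concl≅   : S ≅ concl
    child    : Fin (length prems) → Fin N
    childLab : ∀ k → lab (child k) ≡ Data.List.lookup prems k

-- A regular ∞-proof is presented as a finite graph whose unravelling
-- from the root is the (possibly infinite) proof tree.
record RegGraph : Set where
  field
    N     : ℕ
    lab   : Fin N → Sequent
    node  : ∀ i → Node N lab (lab i)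
    root  : Fin N

  open Node

  arity : Fin N → ℕ
  arity i = length (prems (node i))

  -- infinite branches of the unravelled tree = infinite paths from root
  record InfBranch : Set where
    field
      at    : ℕ → Fin N
      dir   : ∀ k → Fin (arity (at k))
      start : at 0 ≡ root
      next  : ∀ k → child (node (at k)) (dir k) ≡ at (suc k)

  GoodStep : Fm → ∀ {c ps} → Inst c ps → Fin (length ps) → Set
  GoodStep A (axVar _ _ _)       ()
  GoodStep A (ax⊥ _ _)           ()
  GoodStep A (⇒L _ _ _ _)        d = Data.Unit.⊤
    where import Data.Unit
  GoodStep A (⇒R _ _ _ _)        d = Data.Unit.⊤
    where import Data.Unit
  GoodStep A (boxR _ _ _ _ _)    d = Data.Empty.⊥
    where import Data.Empty
  GoodStep A (box⁺R _ _ _ _ B)   d = (B ≡ A) × (d ≡ suc zero)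

  IsBox⁺ : ∀ {c ps} → Inst c ps → Set
  IsBox⁺ (box⁺R _ _ _ _ _) = Data.Unit.⊤
    where import Data.Unit
  IsBox⁺ _                 = Data.Empty.⊥
    where import Data.Empty

  GoodBranch : InfBranch → Set
  GoodBranch b =
    Σ ℕ λ m → Σ Fm λ A →
      (∀ k → m ≤ k → GoodStep A (inst (node (at k))) (dir k))
      × (∀ k → Σ ℕ λ j → (k ≤ j) × IsBox⁺ (inst (node (at j))))
    where open InfBranch b

  -- every infinite branch satisfies the correctness condition
  -- (read classically, hence the double negation)
  IsProof : Set
  IsProof = ∀ (b : InfBranch) → ¬ ¬ GoodBranch b

RegProvable : Sequent → Set
RegProvable S = Σ RegGraph λ G →
  RegGraph.IsProof G × (RegGraph.lab G (RegGraph.root G) ≡ S)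

{-# OPTIONS --safe #-}
module Submission where

-- Completeness by a finite proof search.  Let C be the subformula closure of Γ, Δ.  The
-- invertible rules (→L), (→R) expand a sequent over C into finitely many saturated leaves, and
-- the premise Σ, Π, □⁺Π ⇒ A of a modal rule at such a leaf is determined by a state: two
-- subsets Σ, Π of C and A ∈ C.  The provable states form the least fixed point
-- μX. ⋃ₐ νY. Fₐ(X, Y), where Fₐ(X, Y) consists of the states with target a each leaf of which
-- is an axiom, or has a principal □B whose premise is in X, or a principal □⁺B whose left
-- premise is in X and whose right premise is in X or Y.
--
-- If every leaf of the goal closes in this sense, the provable states with their expansions
-- form a finite graph, a regular ∞-proof.  Rank a state by the stage at which it enters the
-- least fixed point: ranks never increase along edges, and stay equal only through
-- propositional steps, which shrink the sequent, and through right premises of (□⁺) taken from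
-- one greatest fixed point, which share their principal formula.  Otherwise the leaves that do
-- not close form a Kripke countermodel, in which a leaf sees the leaves expanding its modal
-- premises; a □⁺B on the right of a leaf is refuted by descending the approximants of νY.  The
-- soundness of K⁺ excludes such a model.

open import Defs
open Sequent

open import Data.Bool using (Bool; true; false; T; _∧_; _∨_)
open import Data.Bool.Properties using (T-≡; T-∧; T-∨; T-irrelevant)
open import Data.Empty using (⊥; ⊥-elim)
open import Data.Fin using (Fin; zero; suc)
import Data.Fin as Fin
import Data.Fin.Properties as Fin
open import Data.Fin.Subset using (Subset; _⊂_; _⊃_) renaming (_∈_ to _∈ₛ_)
open import Data.Fin.Subset.Induction using (⊂-wellFounded; ⊃-wellFounded)
open import Data.List using (List; []; _∷_; _++_; [_]; map; length; lookup; concatMap; deduplicate; allFin; cartesianProduct)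
open import Data.List.Membership.Propositional using (_∈_; _∉_; find; lose)
open import Data.List.Membership.Propositional.Properties using (∈-++⁺ˡ; ∈-++⁺ʳ; ∈-++⁻; ∈-insert; ∈-∃++; ∈-lookup; ∈-map⁺; ∈-map⁻; ∈-allFin; ∈-cartesianProduct⁺; ∈-concatMap⁺; ∈-concatMap⁻; ∈-deduplicate⁺; ∈-deduplicate⁻)
open import Data.List.Properties using (++-identityʳ)
open import Data.List.Relation.Binary.Disjoint.Propositional using (Disjoint)
open import Data.List.Relation.Binary.Permutation.Propositional using (_↭_; ↭-refl; ↭-trans; ↭-sym; ↭-reflexive; prep)
open import Data.List.Relation.Binary.Permutation.Propositional.Properties using (shift)
open import Data.List.Relation.Binary.Subset.Propositional using (_⊆_)
open import Data.List.Relation.Unary.All using (All; []; _∷_; all?)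
import Data.List.Relation.Unary.All as All
open import Data.List.Relation.Unary.All.Properties using (¬All⇒Any¬)
open import Data.List.Relation.Unary.Any using (Any; here; there; any?; index)
import Data.List.Relation.Unary.Any as Any
open import Data.List.Relation.Unary.Any.Properties using (lookup-index)
open import Data.List.Relation.Unary.Unique.Propositional using (Unique; []; _∷_)
import Data.List.Relation.Unary.Unique.Propositional.Properties as Unique
open import Data.Nat as ℕ using (ℕ; zero; suc; _+_; _≤_; _<_; z≤n; s≤s)
open import Data.Nat.ListAction using (sum)
open import Data.Nat.Properties using (≤-refl; ≤-reflexive; ≤-trans; ≤-pred; <⇒≤; <-≤-trans; <-irrefl; n≤1+n; ≤∧≢⇒<; ≰⇒>; m≤n⇒m<n∨m≡n; m<n⇒m<1+n; m≤n+m; m≤m+n; +-commutativeSemigroup)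
open import Data.Nat.Tactic.RingSolver using (solve-∀)
open import Data.Product using (Σ; ∃; _×_; _,_; proj₁; proj₂; map₂; uncurry)
open import Data.Sum using (_⊎_; inj₁; inj₂; [_,_]′)
import Data.Sum as Sum
open import Data.Unit using (⊤; tt)
open import Data.Vec using (Vec; []; _∷_; tabulate)
import Data.Vec as Vec
open import Data.Vec.Properties using (lookup∘tabulate; lookup⇒[]=; []=⇒lookup)
open import Function using (_∘_; id; _⇔_; Equivalence; mk⇔)
open import Induction.WellFounded using (Acc; acc)
open import Relation.Binary.Construct.Closure.ReflexiveTransitive using (Star; ε; _◅_)
open import Relation.Binary.Construct.Closure.Transitive using (TransClosure; _∷_) renaming ([_] to [_]⁺)
open import Relation.Binary.Definitions using (DecidableEquality)
open import Relation.Binary.PropositionalEquality using (_≡_; refl; sym; trans; cong; cong₂; subst)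
open import Relation.Nullary using (¬_; Dec; yes; no)
open import Relation.Nullary.Decidable using (isYes; toWitness; fromWitness; map′; _×-dec_; _⊎-dec_; _→-dec_; ¬?; T?; decidable-stable)
open import Relation.Nullary.Negation using (¬¬-map)
open import Relation.Unary using (Decidable)

open import Algebra.Properties.CommutativeSemigroup +-commutativeSemigroup using (x∙yz≈y∙xz)

infix 4 _≟_

_≟_ : DecidableEquality Fm
var m ≟ var n = map′ (cong var) (λ { refl → refl }) (m ℕ.≟ n)
⊥' ≟ ⊥' = yes refl
(A ⇒ B) ≟ (A′ ⇒ B′) = map′ (uncurry (cong₂ _⇒_)) (λ { refl → refl , refl }) (A ≟ A′ ×-dec B ≟ B′)
□ A ≟ □ B = map′ (cong □) (λ { refl → refl }) (A ≟ B)
□⁺ A ≟ □⁺ B = map′ (cong □⁺) (λ { refl → refl }) (A ≟ B)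
var _ ≟ ⊥' = no λ ()
var _ ≟ (_ ⇒ _) = no λ ()
var _ ≟ □ _ = no λ ()
var _ ≟ □⁺ _ = no λ ()
⊥' ≟ var _ = no λ ()
⊥' ≟ (_ ⇒ _) = no λ ()
⊥' ≟ □ _ = no λ ()
⊥' ≟ □⁺ _ = no λ ()
(_ ⇒ _) ≟ var _ = no λ ()
(_ ⇒ _) ≟ ⊥' = no λ ()
(_ ⇒ _) ≟ □ _ = no λ ()
(_ ⇒ _) ≟ □⁺ _ = no λ ()
□ _ ≟ var _ = no λ ()
□ _ ≟ ⊥' = no λ ()
□ _ ≟ (_ ⇒ _) = no λ ()
□ _ ≟ □⁺ _ = no λ ()
□⁺ _ ≟ var _ = no λ ()
□⁺ _ ≟ ⊥' = no λ ()
□⁺ _ ≟ (_ ⇒ _) = no λ ()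
□⁺ _ ≟ □ _ = no λ ()

open import Data.List.Membership.DecPropositional _≟_ using (_∈?_)
open import Data.List.Relation.Unary.Unique.DecPropositional.Properties _≟_ using (deduplicate-!)

mutual
  subformulas : Fm → List Fm
  subformulas A = A ∷ properSubformulas A

  properSubformulas : Fm → List Fm
  properSubformulas (A ⇒ B) = subformulas A ++ subformulas B
  properSubformulas (□ A) = subformulas A
  properSubformulas (□⁺ A) = subformulas A
  properSubformulas _ = []

subformulas-trans : ∀ A {B} → B ∈ subformulas A → subformulas B ⊆ subformulas A
subformulas-trans A (here refl) = id
subformulas-trans (A ⇒ B) (there p) with ∈-++⁻ (subformulas A) p
... | inj₁ q = there ∘ ∈-++⁺ˡ ∘ subformulas-trans A q
... | inj₂ q = there ∘ ∈-++⁺ʳ (subformulas A) ∘ subformulas-trans B q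
subformulas-trans (□ A) (there p) = there ∘ subformulas-trans A p
subformulas-trans (□⁺ A) (there p) = there ∘ subformulas-trans A p

SubformulaClosed : List Fm → Set
SubformulaClosed C = ∀ {A} → A ∈ C → subformulas A ⊆ C

subformulaClosure : List Fm → List Fm
subformulaClosure L = deduplicate _≟_ (concatMap subformulas L)

subformulaClosure-⊇ : ∀ L → L ⊆ subformulaClosure L
subformulaClosure-⊇ L A∈L = ∈-deduplicate⁺ _≟_ (∈-concatMap⁺ subformulas {L} (lose A∈L (here refl)))

subformulaClosure-closed : ∀ L → SubformulaClosed (subformulaClosure L)
subformulaClosure-closed L A∈C B∈A
  with B , B∈L , A∈B ← find (∈-concatMap⁻ subformulas {L} (∈-deduplicate⁻ _≟_ _ A∈C))
  = ∈-deduplicate⁺ _≟_ (∈-concatMap⁺ subformulas {L} (lose B∈L (subformulas-trans B A∈B B∈A)))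

module Closure {C : List Fm} (closed : SubformulaClosed C) where

  ⇒-closedˡ : ∀ {A B} → (A ⇒ B) ∈ C → A ∈ C
  ⇒-closedˡ {A} {B} p = closed p (there (∈-++⁺ˡ {ys = subformulas B} (here refl)))

  ⇒-closedʳ : ∀ {A B} → (A ⇒ B) ∈ C → B ∈ C
  ⇒-closedʳ {A} p = closed p (there (∈-++⁺ʳ (subformulas A) (here refl)))

  □-closed : ∀ {A} → □ A ∈ C → A ∈ C
  □-closed p = closed p (there (here refl))

  □⁺-closed : ∀ {A} → □⁺ A ∈ C → A ∈ C
  □⁺-closed p = closed p (there (here refl))

∈-++∷⁻ : ∀ {A : Set} P {R} {x y : A} → x ∈ P ++ y ∷ R → x ≡ y ⊎ x ∈ P ++ R
∈-++∷⁻ P x∈ with ∈-++⁻ P x∈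
... | inj₁ x∈P = inj₂ (∈-++⁺ˡ x∈P)
... | inj₂ (here x≡y) = inj₁ x≡y
... | inj₂ (there x∈R) = inj₂ (∈-++⁺ʳ P x∈R)

∈-++∷⁺ : ∀ {A : Set} P {R} {x y : A} → x ∈ P ++ R → x ∈ P ++ y ∷ R
∈-++∷⁺ P = [ ∈-++⁺ˡ , ∈-++⁺ʳ P ∘ there ]′ ∘ ∈-++⁻ P

∈⇒↭∷ : ∀ {A : Set} {x : A} {Γ} → x ∈ Γ → ∃ λ R → Γ ↭ x ∷ R
∈⇒↭∷ {x = x} x∈Γ with P , R , refl ← ∈-∃++ x∈Γ = P ++ R , shift x P R

◅⁺ : ∀ {W : Set} {R : W → W → Set} {w v u} → R w v → Star R v u → TransClosure R w u
◅⁺ r ε = [ r ]⁺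
◅⁺ r (r′ ◅ rs) = r ∷ ◅⁺ r′ rs

∈⇒lookup : ∀ {A : Set} {xs : List A} {x} → x ∈ xs → ∃ λ i → lookup xs i ≡ x
∈⇒lookup x∈ = index x∈ , sym (lookup-index x∈)

↭-extract : ∀ {A : Set} {ys Γ : List A} → Unique ys → ys ⊆ Γ → ∃ λ Υ → Γ ↭ Υ ++ ys
↭-extract {ys = []} {Γ} [] _ = Γ , ↭-reflexive (sym (++-identityʳ Γ))
↭-extract {ys = y ∷ ys} (y∉ys ∷ u) ys⊆Γ with P , R , refl ← ∈-∃++ (ys⊆Γ (here refl)) =
  let Υ , P++R↭ = ↭-extract u ys⊆P++R
  in Υ , ↭-trans (shift y P R) (↭-trans (prep y P++R↭) (↭-sym (shift y Υ ys)))
  where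
  ys⊆P++R : ys ⊆ P ++ R
  ys⊆P++R z∈ys with ∈-++∷⁻ P (ys⊆Γ (there z∈ys))
  ... | inj₁ refl = ⊥-elim (All.lookup y∉ys z∈ys refl)
  ... | inj₂ z∈P++R = z∈P++R

select : ∀ {A : Set} (xs : List A) → Subset (length xs) → List A
select [] [] = []
select (x ∷ xs) (true ∷ σ) = x ∷ select xs σ
select (x ∷ xs) (false ∷ σ) = select xs σ

module _ {A : Set} where

  ∈-select⁺ : ∀ (xs : List A) σ i → T (Vec.lookup σ i) → lookup xs i ∈ select xs σ
  ∈-select⁺ (x ∷ xs) (true ∷ σ) zero _ = here refl
  ∈-select⁺ (x ∷ xs) (true ∷ σ) (suc i) t = there (∈-select⁺ xs σ i t)
  ∈-select⁺ (x ∷ xs) (false ∷ σ) (suc i) t = ∈-select⁺ xs σ i t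

  ∈-select⁻ : ∀ (xs : List A) σ {y} → y ∈ select xs σ → ∃ λ i → y ≡ lookup xs i × T (Vec.lookup σ i)
  ∈-select⁻ [] [] ()
  ∈-select⁻ (x ∷ xs) (true ∷ σ) (here refl) = zero , refl , _
  ∈-select⁻ (x ∷ xs) (true ∷ σ) (there y∈) = let i , eq , t = ∈-select⁻ xs σ y∈ in suc i , eq , t
  ∈-select⁻ (x ∷ xs) (false ∷ σ) y∈ = let i , eq , t = ∈-select⁻ xs σ y∈ in suc i , eq , t

  select-⊆ : ∀ (xs : List A) σ → select xs σ ⊆ xs
  select-⊆ xs σ y∈ with i , refl , _ ← ∈-select⁻ xs σ y∈ = ∈-lookup i

  select-unique : ∀ {xs : List A} σ → Unique xs → Unique (select xs σ)
  select-unique {[]} [] [] = []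
  select-unique {x ∷ xs} (true ∷ σ) (x∉ ∷ u) = All.tabulate (All.lookup x∉ ∘ select-⊆ xs σ) ∷ select-unique σ u
  select-unique {x ∷ xs} (false ∷ σ) (_ ∷ u) = select-unique σ u

allSubsets : ∀ n → List (Subset n)
allSubsets zero = [ [] ]
allSubsets (suc n) = map (true ∷_) (allSubsets n) ++ map (false ∷_) (allSubsets n)

∈-allSubsets : ∀ {n} (σ : Subset n) → σ ∈ allSubsets n
∈-allSubsets [] = here refl
∈-allSubsets (true ∷ σ) = ∈-++⁺ˡ (∈-map⁺ (true ∷_) (∈-allSubsets σ))
∈-allSubsets (false ∷ σ) = ∈-++⁺ʳ _ (∈-map⁺ (false ∷_) (∈-allSubsets σ))

-- Kripke semantics

module Kripke {W : Set} (R : W → W → Set) (V : W → ℕ → Bool) where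

  R⁺ : W → W → Set
  R⁺ = TransClosure R

  infix 4 _⊨_

  _⊨_ : W → Fm → Set
  w ⊨ var n = T (V w n)
  w ⊨ ⊥' = ⊥
  w ⊨ (A ⇒ B) = w ⊨ A → w ⊨ B
  w ⊨ □ A = ∀ {v} → R w v → v ⊨ A
  w ⊨ □⁺ A = ∀ {v} → R⁺ w v → v ⊨ A

  ⊨-stable : ∀ A {w} → ¬ ¬ w ⊨ A → w ⊨ A
  ⊨-stable (var n) {w} = decidable-stable (T? (V w n))
  ⊨-stable ⊥' ¬¬⊥ = ¬¬⊥ id
  ⊨-stable (A ⇒ B) ¬¬f a = ⊨-stable B (¬¬-map (λ f → f a) ¬¬f)
  ⊨-stable (□ A) ¬¬f r = ⊨-stable A (¬¬-map (λ f → f r) ¬¬f)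
  ⊨-stable (□⁺ A) ¬¬f r = ⊨-stable A (¬¬-map (λ f → f r) ¬¬f)

  ⊨-∧⁻ : ∀ A B {w} → w ⊨ A ∧' B → w ⊨ A × w ⊨ B
  ⊨-∧⁻ A B ¬[A⇒¬B] = ⊨-stable A (λ ¬a → ¬[A⇒¬B] (λ a _ → ¬a a))
                    , ⊨-stable B (λ ¬b → ¬[A⇒¬B] (λ _ b → ¬b b))

  ⊨-induction : ∀ A {u v} → u ⊨ □ A → u ⊨ □⁺ (A ⇒ □ A) → R⁺ u v → v ⊨ A
  ⊨-induction A □A □⁺step [ r ]⁺ = □A r
  ⊨-induction A □A □⁺step (r ∷ r⁺) = ⊨-induction A (□⁺step [ r ]⁺ (□A r)) (□⁺step ∘ (r ∷_)) r⁺

  soundness : ∀ {A} → K⁺⊢ A → ∀ w → w ⊨ A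
  soundness ax1 w a _ = a
  soundness ax2 w f g a = f a (g a)
  soundness (ax3 {A}) w = ⊨-stable A
  soundness kBox w f g r = f r (g r)
  soundness kBox⁺ w f g r = f r (g r)
  soundness ax⁺1 w f r = f [ r ]⁺
  soundness ax⁺2 w f r r⁺ = f (r ∷ r⁺)
  soundness (ind {A}) w h = uncurry (⊨-induction A) (⊨-∧⁻ (□ A) (□⁺ (A ⇒ □ A)) h)
  soundness (mp d e) w = soundness d w (soundness e w)
  soundness (nec d) w {v} _ = soundness d v

  ⊨-⋀ : ∀ Γ {w} → (∀ {A} → A ∈ Γ → w ⊨ A) → w ⊨ ⋀ Γ
  ⊨-⋀ [] _ = id
  ⊨-⋀ (A ∷ Γ) ⊨Γ A⇒¬⋀Γ = A⇒¬⋀Γ (⊨Γ (here refl)) (⊨-⋀ Γ (⊨Γ ∘ there))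

  ⊭-⋁ : ∀ Δ {w} → (∀ {A} → A ∈ Δ → ¬ w ⊨ A) → ¬ w ⊨ ⋁ Δ
  ⊭-⋁ [] _ = id
  ⊭-⋁ (A ∷ Δ) ⊭Δ ¬A⇒⋁Δ = ⊭-⋁ Δ (⊭Δ ∘ there) (¬A⇒⋁Δ (⊭Δ (here refl)))

  no-countermodel : ∀ {Γ Δ w} → K⁺⊢ (⋀ Γ ⇒ ⋁ Δ) →
                    (∀ {A} → A ∈ Γ → w ⊨ A) → (∀ {A} → A ∈ Δ → ¬ w ⊨ A) → ⊥
  no-countermodel {Γ} {Δ} {w} d ⊨Γ ⊭Δ = ⊭-⋁ Δ ⊭Δ (soundness d w (⊨-⋀ Γ ⊨Γ))

-- Stabilisation of monotone sequences

module _ (f : ℕ → ℕ) (f-step : ∀ k → f (suc k) ≤ f k) where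

  antitone : ∀ {i k} → i ≤ k → f k ≤ f i
  antitone {k = zero} z≤n = ≤-refl
  antitone {k = suc k} i≤1+k with m≤n⇒m<n∨m≡n i≤1+k
  ... | inj₁ (s≤s i≤k) = ≤-trans (f-step k) (antitone i≤k)
  ... | inj₂ refl = ≤-refl

  ¬¬-eventually-constant : ¬ ¬ ∃ λ m → ∀ k → m ≤ k → f k ≡ f m
  ¬¬-eventually-constant = below (f 0) 0 ≤-refl
    where
    -- Induction on a bound v of f i: unless f is constant from i on, it drops below f i ≤ v.
    below : ∀ v i → f i ≤ v → ¬ ¬ ∃ λ m → ∀ k → m ≤ k → f k ≡ f m
    below v i fi≤v ¬const = ¬const (i , constant)
      where
      constant : ∀ k → i ≤ k → f k ≡ f i
      constant k i≤k with f k ℕ.≟ f i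
      ... | yes fk≡fi = fk≡fi
      ... | no fk≢fi = ⊥-elim (smaller v (<-≤-trans (≤∧≢⇒< (antitone i≤k) fk≢fi) fi≤v))
        where
        smaller : ∀ v → f k < v → ⊥
        smaller (suc v′) (s≤s fk≤v′) = below v′ k fk≤v′ ¬const

infix 4 _⊆ᵇ_

_⊆ᵇ_ : {S : Set} → (S → Bool) → (S → Bool) → Set
X ⊆ᵇ Y = ∀ s → T (X s) → T (Y s)

module _ {S : Set} (U : List S) (U-complete : ∀ s → s ∈ U) where

  ⊆ᵇ-or-witness : ∀ X Y → X ⊆ᵇ Y ⊎ ∃ λ s → T (X s) × ¬ T (Y s)
  ⊆ᵇ-or-witness X Y with any? (λ s → T? (X s) ×-dec ¬? (T? (Y s))) U
  ... | yes p = inj₂ (let s , _ , new = find p in s , new)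
  ... | no ¬p = inj₁ λ s Xs → decidable-stable (T? (Y s)) λ ¬Ys → ¬p (lose (U-complete s) (Xs , ¬Ys))

  private
    toSubset : (S → Bool) → Subset (length U)
    toSubset X = tabulate (X ∘ lookup U)

    ∈-toSubset : ∀ X {i} → i ∈ₛ toSubset X ⇔ T (X (lookup U i))
    ∈-toSubset X {i} = mk⇔
      (λ i∈ → Equivalence.from T-≡ (trans (sym (lookup∘tabulate _ i)) ([]=⇒lookup i∈)))
      (λ t → lookup⇒[]= i _ (trans (lookup∘tabulate _ i) (Equivalence.to T-≡ t)))

    toSubset-⊂ : ∀ {X Y} s → X ⊆ᵇ Y → T (Y s) → ¬ T (X s) → toSubset X ⊂ toSubset Y
    toSubset-⊂ {X} {Y} s X⊆Y Ys ¬Xs =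
        (λ i∈X → Equivalence.from (∈-toSubset Y) (X⊆Y _ (Equivalence.to (∈-toSubset X) i∈X)))
      , index s∈U
      , Equivalence.from (∈-toSubset Y) (subst (T ∘ Y) s≡ Ys)
      , ¬Xs ∘ subst (T ∘ X) (sym s≡) ∘ Equivalence.to (∈-toSubset X)
      where
      s∈U : s ∈ U
      s∈U = U-complete s
      s≡ : s ≡ lookup U (index s∈U)
      s≡ = lookup-index s∈U

  -- Only the existence of the index matters; unfolding the search would make type checking
  -- the fixed points built from these lemmas very slow.
  abstract
    increasing-chain-stabilises : (Ch : ℕ → S → Bool) → (∀ k → Ch k ⊆ᵇ Ch (suc k)) →
                                  ∃ λ k → Ch (suc k) ⊆ᵇ Ch k
    increasing-chain-stabilises Ch inc = go 0 (⊃-wellFounded (toSubset (Ch 0)))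
      where
      go : ∀ k → Acc _⊃_ (toSubset (Ch k)) → ∃ λ k → Ch (suc k) ⊆ᵇ Ch k
      go k (acc larger) with ⊆ᵇ-or-witness (Ch (suc k)) (Ch k)
      ... | inj₁ stable = k , stable
      ... | inj₂ (s , new , ¬old) = go (suc k) (larger (toSubset-⊂ s (inc k) new ¬old))

    decreasing-chain-stabilises : (Ch : ℕ → S → Bool) → (∀ k → Ch (suc k) ⊆ᵇ Ch k) →
                                  ∃ λ k → Ch k ⊆ᵇ Ch (suc k)
    decreasing-chain-stabilises Ch dec = go 0 (⊂-wellFounded (toSubset (Ch 0)))
      where
      go : ∀ k → Acc _⊂_ (toSubset (Ch k)) → ∃ λ k → Ch k ⊆ᵇ Ch (suc k)
      go k (acc smaller) with ⊆ᵇ-or-witness (Ch k) (Ch (suc k))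
      ... | inj₁ stable = k , stable
      ... | inj₂ (s , old , ¬new) = go (suc k) (smaller (toSubset-⊂ s (dec k) old ¬new))

-- Regular proofs from ranked graphs

-- RegGraph.GoodStep and RegGraph.IsBox⁺, restated outside RegGraph so that they can be
-- used while the graph is still being built.
Tracks : Fm → ∀ {c ps} → Inst c ps → Fin (length ps) → Set
Tracks A (axVar _ _ _) ()
Tracks A (ax⊥ _ _) ()
Tracks A (⇒L _ _ _ _) _ = ⊤
Tracks A (⇒R _ _ _ _) _ = ⊤
Tracks A (boxR _ _ _ _ _) _ = ⊥
Tracks A (box⁺R _ _ _ _ B) d = B ≡ A × d ≡ suc zero

IsBox⁺Rule : ∀ {c ps} → Inst c ps → Set
IsBox⁺Rule (box⁺R _ _ _ _ _) = ⊤
IsBox⁺Rule _ = ⊥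

isBox⁺Rule? : ∀ {c ps} (r : Inst c ps) → Dec (IsBox⁺Rule r)
isBox⁺Rule? (axVar _ _ _) = no λ ()
isBox⁺Rule? (ax⊥ _ _) = no λ ()
isBox⁺Rule? (⇒L _ _ _ _) = no λ ()
isBox⁺Rule? (⇒R _ _ _ _) = no λ ()
isBox⁺Rule? (boxR _ _ _ _ _) = no λ ()
isBox⁺Rule? (box⁺R _ _ _ _ _) = yes tt

module RankedGraph (G : RegGraph) where
  open RegGraph G
  open Node

  tracks⇒goodStep : ∀ A {c ps} (r : Inst c ps) d → Tracks A r d → GoodStep A r d
  tracks⇒goodStep A (⇒L _ _ _ _) d t = t
  tracks⇒goodStep A (⇒R _ _ _ _) d t = t
  tracks⇒goodStep A (box⁺R _ _ _ _ _) d t = t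

  isBox⁺Rule⇒isBox⁺ : ∀ {c ps} (r : Inst c ps) → IsBox⁺Rule r → IsBox⁺ r
  isBox⁺Rule⇒isBox⁺ (box⁺R _ _ _ _ _) t = t

  module _ (rank : Fin N → ℕ) (track : Fin N → Fm) (measure : Fin N → ℕ)
    (rank-antitone : ∀ i d → rank (child (node i) d) ≤ rank i)
    (rank-stable : ∀ i d → rank (child (node i) d) ≡ rank i →
                   Tracks (track i) (inst (node i)) d × track (child (node i) d) ≡ track i)
    (progress : ∀ i d → ¬ IsBox⁺Rule (inst (node i)) →
                measure (child (node i) d) < measure i ⊎ rank (child (node i) d) < rank i)
    where

    ranked⇒proof : IsProof
    ranked⇒proof b = ¬¬-map good (¬¬-eventually-constant (rank ∘ at) rank-step)
      where
      open InfBranch b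

      along : ∀ (P : Fin N → Set) k → P (child (node (at k)) (dir k)) → P (at (suc k))
      along P k = subst P (next k)

      rank-step : ∀ k → rank (at (suc k)) ≤ rank (at k)
      rank-step k = along (λ j → rank j ≤ rank (at k)) k (rank-antitone (at k) (dir k))

      good : (∃ λ m → ∀ k → m ≤ k → rank (at k) ≡ rank (at m)) → GoodBranch b
      good (m , constant) = m , track (at m) , tracked , box⁺-ahead
        where
        same-rank : ∀ {k} → m ≤ k → rank (child (node (at k)) (dir k)) ≡ rank (at k)
        same-rank {k} m≤k = subst (λ j → rank j ≡ rank (at k)) (sym (next k))
          (trans (constant (suc k) (≤-trans m≤k (n≤1+n k))) (sym (constant k m≤k)))

        stable-step : ∀ {k} → m ≤ k →
          Tracks (track (at k)) (inst (node (at k))) (dir k) × track (at (suc k)) ≡ track (at k)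
        stable-step {k} m≤k =
          map₂ (along (λ j → track j ≡ track (at k)) k) (rank-stable (at k) (dir k) (same-rank m≤k))

        track-constant : ∀ {k} → m ≤ k → track (at k) ≡ track (at m)
        track-constant {zero} z≤n = refl
        track-constant {suc k} m≤1+k with m≤n⇒m<n∨m≡n m≤1+k
        ... | inj₁ (s≤s m≤k) = trans (proj₂ (stable-step m≤k)) (track-constant m≤k)
        ... | inj₂ refl = refl

        tracked : ∀ k → m ≤ k → GoodStep (track (at m)) (inst (node (at k))) (dir k)
        tracked k m≤k = tracks⇒goodStep _ (inst (node (at k))) (dir k)
          (subst (λ A → Tracks A (inst (node (at k))) (dir k)) (track-constant m≤k) (proj₁ (stable-step m≤k)))

        -- Without a (□⁺) step the measure would decrease forever, since the rank stays fixed.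
        box⁺-within : ∀ n k → m ≤ k → measure (at k) ≤ n → ∃ λ j → k ≤ j × IsBox⁺ (inst (node (at j)))
        box⁺-within n k m≤k μ≤n with isBox⁺Rule? (inst (node (at k)))
        ... | yes b = k , ≤-refl , isBox⁺Rule⇒isBox⁺ _ b
        ... | no ¬b with progress (at k) (dir k) ¬b
        ...   | inj₂ rank< = ⊥-elim (<-irrefl (same-rank m≤k) rank<)
        ...   | inj₁ μ< with n | <-≤-trans (along (λ j → measure j < measure (at k)) k μ<) μ≤n
        ...     | suc n′ | s≤s μ≤n′ =
          let j , 1+k≤j , b = box⁺-within n′ (suc k) (≤-trans m≤k (n≤1+n k)) μ≤n′
          in j , ≤-trans (n≤1+n k) 1+k≤j , b

        box⁺-ahead : ∀ k → ∃ λ j → k ≤ j × IsBox⁺ (inst (node (at j)))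
        box⁺-ahead k with box⁺-within (measure (at (k + m))) (k + m) (m≤n+m m k) ≤-refl
        ... | j , k+m≤j , b = j , ≤-trans (m≤m+n k m) k+m≤j , b

module _ {I : Set} (label : I → Sequent) (rank : I → ℕ) (track : I → Fm) (measure : I → ℕ) where

  record RankedNode (S : Sequent) (r : ℕ) (A : Fm) (m : ℕ) : Set where
    field
      concl         : Sequent
      prems         : List Sequent
      inst          : Inst concl prems
      concl≅        : S ≅ concl
      child         : Fin (length prems) → I
      child-label   : ∀ d → label (child d) ≡ lookup prems d
      rank-antitone : ∀ d → rank (child d) ≤ r
      rank-stable   : ∀ d → rank (child d) ≡ r → Tracks A inst d × track (child d) ≡ A
      progress      : ∀ d → ¬ IsBox⁺Rule inst → measure (child d) < m ⊎ rank (child d) < r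

  ranked⇒regProvable : (enum : List I) → (∀ i → i ∈ enum) →
                       (∀ i → RankedNode (label i) (rank i) (track i) (measure i)) →
                       ∀ root → RegProvable (label root)
  ranked⇒regProvable enum complete ranked root = G , proof , cong label (decode-encode root)
    where
    decode : Fin (length enum) → I
    decode = lookup enum

    encode : I → Fin (length enum)
    encode i = index (complete i)

    decode-encode : ∀ i → decode (encode i) ≡ i
    decode-encode i = sym (lookup-index (complete i))

    transport : ∀ (P : I → Set) {i} → P i → P (decode (encode i))
    transport P {i} = subst P (sym (decode-encode i))

    graphNode : ∀ k → Node (length enum) (label ∘ decode) (label (decode k))
    graphNode k = record
      { concl = concl ; prems = prems ; inst = inst ; concl≅ = concl≅
      ; child = encode ∘ child
      ; childLab = λ d → trans (cong label (decode-encode (child d))) (child-label d) }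
      where open RankedNode (ranked (decode k))

    G : RegGraph
    G = record { N = length enum ; lab = label ∘ decode ; node = graphNode ; root = encode root }

    proof : RegGraph.IsProof G
    proof = RankedGraph.ranked⇒proof G (rank ∘ decode) (track ∘ decode) (measure ∘ decode)
      (λ k d → transport (λ i → rank i ≤ _) (rank-antitone (ranked (decode k)) d))
      (λ k d eq → map₂ (transport (λ i → track i ≡ _))
        (rank-stable (ranked (decode k)) d (subst (λ i → rank i ≡ _) (decode-encode _) eq)))
      (λ k d ¬b → Sum.map (transport (λ i → measure i < _)) (transport (λ i → rank i < _))
        (progress (ranked (decode k)) d ¬b))
      where open RankedNode

-- Propositional expansion

data IsImp : Fm → Set where
  imp : ∀ {A B} → IsImp (A ⇒ B)

isImp? : Decidable IsImp
isImp? (var _) = no λ ()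
isImp? ⊥' = no λ ()
isImp? (_ ⇒ _) = yes imp
isImp? (□ _) = no λ ()
isImp? (□⁺ _) = no λ ()

Saturated : List Fm → Set
Saturated Γ = ¬ Any IsImp Γ

saturated? : Decidable Saturated
saturated? Γ = ¬? (any? isImp? Γ)

saturated-∌⇒ : ∀ {Γ A B} → Saturated Γ → (A ⇒ B) ∉ Γ
saturated-∌⇒ sat = sat ∘ Any.map λ { refl → imp }

data Shape : Sequent → Set where
  ⇒L-shape  : ∀ P A B R Δ → Shape ((P ++ (A ⇒ B) ∷ R) ⊢ Δ)
  ⇒R-shape  : ∀ Γ P A B R → Shape (Γ ⊢ (P ++ (A ⇒ B) ∷ R))
  saturated : ∀ {Γ Δ} → Saturated Γ → Saturated Δ → Shape (Γ ⊢ Δ)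

drop-imp : ∀ P {R C A B} → ¬ IsImp C → C ∈ P ++ (A ⇒ B) ∷ R → C ∈ P ++ R
drop-imp P ¬imp C∈ with ∈-++∷⁻ P C∈
... | inj₁ refl = ⊥-elim (¬imp imp)
... | inj₂ C∈P++R = C∈P++R

split-imp : ∀ {Γ} → Any IsImp Γ → ∃ λ P → ∃ λ A → ∃ λ B → ∃ λ R → Γ ≡ P ++ (A ⇒ B) ∷ R
split-imp p with _ , A⇒B∈Γ , imp ← find p = let P , R , eq = ∈-∃++ A⇒B∈Γ in P , _ , _ , R , eq

shape : ∀ q → Shape q
shape (Γ ⊢ Δ) with any? isImp? Γ | any? isImp? Δ
... | yes p | _ with P , A , B , R , refl ← split-imp p = ⇒L-shape P A B R Δ
... | no ¬p | yes p with P , A , B , R , refl ← split-imp p = ⇒R-shape Γ P A B R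
... | no ¬p | no ¬p′ = saturated ¬p ¬p′

premises : ∀ {q} → Shape q → List Sequent
premises (⇒L-shape P A B R Δ) = ((B ∷ P ++ R) ⊢ Δ) ∷ ((P ++ R) ⊢ (A ∷ Δ)) ∷ []
premises (⇒R-shape Γ P A B R) = ((A ∷ Γ) ⊢ (B ∷ P ++ R)) ∷ []
premises (saturated _ _) = []

infix 4 _⟶_ _⟶*_

_⟶_ : Sequent → Sequent → Set
q ⟶ q′ = q′ ∈ premises (shape q)

_⟶*_ : Sequent → Sequent → Set
_⟶*_ = Star _⟶_

size : Fm → ℕ
size (A ⇒ B) = suc (size A + size B)
size _ = 1

sizes : List Fm → ℕ
sizes = sum ∘ map size

weight : Sequent → ℕ
weight (Γ ⊢ Δ) = sizes Γ + sizes Δ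

sizes-++∷ : ∀ P A R → sizes (P ++ A ∷ R) ≡ size A + sizes (P ++ R)
sizes-++∷ [] A R = refl
sizes-++∷ (B ∷ P) A R =
  trans (cong (size B +_) (sizes-++∷ P A R)) (x∙yz≈y∙xz (size B) (size A) (sizes (P ++ R)))

private
  lighter : ∀ {m n} k → n ≡ suc m + k → m < n
  lighter {m} k refl = m≤m+n (suc m) k

  ⇒L-weightˡ : ∀ a b x y → (suc (a + b) + x) + y ≡ suc ((b + x) + y) + a
  ⇒L-weightˡ = solve-∀

  ⇒L-weightʳ : ∀ a b x y → (suc (a + b) + x) + y ≡ suc (x + (a + y)) + b
  ⇒L-weightʳ = solve-∀

  ⇒R-weight : ∀ a b g x → g + (suc (a + b) + x) ≡ suc ((a + g) + (b + x))
  ⇒R-weight = solve-∀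

premises-lighter : ∀ {q} (s : Shape q) → All (λ q′ → weight q′ < weight q) (premises s)
premises-lighter (⇒L-shape P A B R Δ) rewrite sizes-++∷ P (A ⇒ B) R =
  lighter (size A) (⇒L-weightˡ (size A) (size B) (sizes (P ++ R)) (sizes Δ)) ∷
  lighter (size B) (⇒L-weightʳ (size A) (size B) (sizes (P ++ R)) (sizes Δ)) ∷ []
premises-lighter (⇒R-shape Γ P A B R) rewrite sizes-++∷ P (A ⇒ B) R =
  ≤-reflexive (sym (⇒R-weight (size A) (size B) (sizes Γ) (sizes (P ++ R)))) ∷ []
premises-lighter (saturated _ _) = []

⟶-lighter : ∀ {q q′} → q ⟶ q′ → weight q′ < weight q
⟶-lighter {q} = All.lookup (premises-lighter (shape q))

expand : ℕ → Sequent → List Sequent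
expand zero q = []
expand (suc n) q = q ∷ concatMap (expand n) (premises (shape q))

expansion : Sequent → List Sequent
expansion q = expand (suc (weight q)) q

∈-expand⇒⟶* : ∀ n {q x} → x ∈ expand n q → q ⟶* x
∈-expand⇒⟶* (suc n) (here refl) = ε
∈-expand⇒⟶* (suc n) {q} (there x∈) with _ , q⟶q′ , x∈′ ← find (∈-concatMap⁻ (expand n) {premises (shape q)} x∈) =
  q⟶q′ ◅ ∈-expand⇒⟶* n x∈′

∈-expansion⇒⟶* : ∀ {q x} → x ∈ expansion q → q ⟶* x
∈-expansion⇒⟶* = ∈-expand⇒⟶* _

expand-closed : ∀ n {q x y} → weight q < n → x ∈ expand n q → x ⟶ y → y ∈ expand n q
expand-closed (suc n) {q} (s≤s w≤n) (here refl) q⟶y with n | <-≤-trans (⟶-lighter q⟶y) w≤n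
... | suc n′ | _ = there (∈-concatMap⁺ (expand (suc n′)) (lose q⟶y (here refl)))
expand-closed (suc n) {q} (s≤s w≤n) (there x∈) x⟶y
  with q′ , q⟶q′ , x∈′ ← find (∈-concatMap⁻ (expand n) {premises (shape q)} x∈) =
  there (∈-concatMap⁺ (expand n) (lose q⟶q′ (expand-closed n (<-≤-trans (⟶-lighter q⟶q′) w≤n) x∈′ x⟶y)))

expansion-closed : ∀ {q x y} → x ∈ expansion q → x ⟶ y → y ∈ expansion q
expansion-closed = expand-closed _ ≤-refl

Keeps : Fm → Sequent → Sequent → Set
Keeps A q q′ = (A ∈ ant q → A ∈ ant q′) × (A ∈ suc' q → A ∈ suc' q′)

premises-keep : ∀ {q} (s : Shape q) {A} → ¬ IsImp A → All (Keeps A q) (premises s)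
premises-keep (⇒L-shape P _ _ R _) ¬imp = (there ∘ drop-imp P ¬imp , id) ∷ (drop-imp P ¬imp , there) ∷ []
premises-keep (⇒R-shape _ P _ _ R) ¬imp = (there , there ∘ drop-imp P ¬imp) ∷ []
premises-keep (saturated _ _) _ = []

⟶-keeps : ∀ {q q′ A} → q ⟶ q′ → ¬ IsImp A → Keeps A q q′
⟶-keeps {q} q⟶ ¬imp = All.lookup (premises-keep (shape q) ¬imp) q⟶

⟶*-keeps : ∀ {q q′ A} → q ⟶* q′ → ¬ IsImp A → Keeps A q q′
⟶*-keeps ε _ = id , id
⟶*-keeps {q} (q⟶ ◅ path) ¬imp =
  let ka , ks = ⟶-keeps {q} q⟶ ¬imp ; ka′ , ks′ = ⟶*-keeps path ¬imp
  in ka′ ∘ ka , ks′ ∘ ks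

Over : List Fm → Sequent → Set
Over C q = ant q ⊆ C × suc' q ⊆ C

module _ {C} (closed : SubformulaClosed C) where
  open Closure closed

  private
    ∷-⊆ : ∀ {x xs} → x ∈ C → xs ⊆ C → x ∷ xs ⊆ C
    ∷-⊆ x∈C xs⊆C (here refl) = x∈C
    ∷-⊆ x∈C xs⊆C (there y∈) = xs⊆C y∈

  premises-over : ∀ {q} (s : Shape q) → Over C q → All (Over C) (premises s)
  premises-over (⇒L-shape P A B R Δ) (Γ⊆ , Δ⊆) =
      (∷-⊆ (⇒-closedʳ A⇒B∈C) (Γ⊆ ∘ ∈-++∷⁺ P) , Δ⊆)
    ∷ (Γ⊆ ∘ ∈-++∷⁺ P , ∷-⊆ (⇒-closedˡ A⇒B∈C) Δ⊆) ∷ []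
    where
    A⇒B∈C : (A ⇒ B) ∈ C
    A⇒B∈C = Γ⊆ (∈-insert P)
  premises-over (⇒R-shape Γ P A B R) (Γ⊆ , Δ⊆) =
    (∷-⊆ (⇒-closedˡ A⇒B∈C) Γ⊆ , ∷-⊆ (⇒-closedʳ A⇒B∈C) (Δ⊆ ∘ ∈-++∷⁺ P)) ∷ []
    where
    A⇒B∈C : (A ⇒ B) ∈ C
    A⇒B∈C = Δ⊆ (∈-insert P)
  premises-over (saturated _ _) _ = []

  ⟶*-over : ∀ {q q′} → q ⟶* q′ → Over C q → Over C q′
  ⟶*-over ε = id
  ⟶*-over {q} (q⟶ ◅ path) = ⟶*-over path ∘ (λ ov → All.lookup (premises-over (shape q) ov) q⟶)

-- Proof search

data IsVar : Fm → Set where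
  is-var : ∀ {n} → IsVar (var n)

isVar? : Decidable IsVar
isVar? (var _) = yes is-var
isVar? ⊥' = no λ ()
isVar? (_ ⇒ _) = no λ ()
isVar? (□ _) = no λ ()
isVar? (□⁺ _) = no λ ()

Axiomatic : Sequent → Set
Axiomatic (Γ ⊢ Δ) = ⊥' ∈ Γ ⊎ Any (λ A → IsVar A × A ∈ Δ) Γ

axiomatic? : Decidable Axiomatic
axiomatic? (Γ ⊢ Δ) = ⊥' ∈? Γ ⊎-dec any? (λ A → isVar? A ×-dec A ∈? Δ) Γ

module Search (C : List Fm) where

  -- A state (σ , π , i) stands for the premise Σ, Π, □⁺Π ⇒ Cᵢ of a modal rule, where σ and π
  -- select Σ and Π from C.
  State : Set
  State = Subset (length C) × Subset (length C) × Fin (length C)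

  target : State → Fin (length C)
  target (_ , _ , i) = i

  allStates : List State
  allStates = cartesianProduct (allSubsets _) (cartesianProduct (allSubsets _) (allFin _))

  ∈-allStates : ∀ t → t ∈ allStates
  ∈-allStates (σ , π , i) =
    ∈-cartesianProduct⁺ (∈-allSubsets σ) (∈-cartesianProduct⁺ (∈-allSubsets π) (∈-allFin i))

  modalPremise : Subset (length C) → Subset (length C) → Fm → Sequent
  modalPremise σ π A = (select C σ ++ select C π ++ map □⁺ (select C π)) ⊢ [ A ]

  premise : State → Sequent
  premise (σ , π , i) = modalPremise σ π (lookup C i)

  boxed : (Fm → Fm) → List Fm → Subset (length C)
  boxed ○ Γ = tabulate λ i → isYes (○ (lookup C i) ∈? Γ)

  ∈-boxed : ∀ ○ Γ i → T (Vec.lookup (boxed ○ Γ) i) ⇔ ○ (lookup C i) ∈ Γ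
  ∈-boxed ○ Γ i rewrite lookup∘tabulate (λ i → isYes (○ (lookup C i) ∈? Γ)) i = mk⇔ toWitness fromWitness

  boxed-⊆ : ∀ ○ Γ → map ○ (select C (boxed ○ Γ)) ⊆ Γ
  boxed-⊆ ○ Γ y∈ with _ , A∈ , refl ← ∈-map⁻ ○ y∈ with i , refl , t ← ∈-select⁻ C (boxed ○ Γ) A∈ =
    Equivalence.to (∈-boxed ○ Γ i) t

  boxed-∈ : ∀ ○ Γ i → ○ (lookup C i) ∈ Γ → lookup C i ∈ select C (boxed ○ Γ)
  boxed-∈ ○ Γ i ○Cᵢ∈Γ = ∈-select⁺ C (boxed ○ Γ) i (Equivalence.from (∈-boxed ○ Γ i) ○Cᵢ∈Γ)

  boxedContext : List Fm → List Fm → List Fm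
  boxedContext Υ Γ = Υ ++ map □ (select C (boxed □ Γ)) ++ map □⁺ (select C (boxed □⁺ Γ))

  stateAt : Sequent → Fin (length C) → State
  stateAt q i = boxed □ (ant q) , boxed □⁺ (ant q) , i

  data ClosedBy (X Y : State → Bool) (q : Sequent) : Fm → Set where
    by-□  : ∀ {B} i → lookup C i ≡ B → T (X (stateAt q i)) → ClosedBy X Y q (□ B)
    by-□⁺ : ∀ {B} i j → lookup C i ≡ B → lookup C j ≡ □⁺ B → T (X (stateAt q i)) →
                T (X (stateAt q j)) ⊎ T (Y (stateAt q j)) → ClosedBy X Y q (□⁺ B)

  closedBy? : ∀ X Y q → Decidable (ClosedBy X Y q)
  closedBy? X Y q (□ B) =
    map′ (λ (i , eq , x) → by-□ i eq x) (λ { (by-□ i eq x) → i , eq , x })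
      (Fin.any? λ i → lookup C i ≟ B ×-dec T? (X (stateAt q i)))
  closedBy? X Y q (□⁺ B) =
    map′ (λ (i , eq , x , j , eq′ , xy) → by-□⁺ i j eq eq′ x xy)
         (λ { (by-□⁺ i j eq eq′ x xy) → i , eq , x , j , eq′ , xy })
      (Fin.any? λ i → lookup C i ≟ B ×-dec T? (X (stateAt q i)) ×-dec
        Fin.any? λ j → lookup C j ≟ □⁺ B ×-dec (T? (X (stateAt q j)) ⊎-dec T? (Y (stateAt q j))))
  closedBy? X Y q (var _) = no λ ()
  closedBy? X Y q ⊥' = no λ ()
  closedBy? X Y q (_ ⇒ _) = no λ ()

  Closes : (X Y : State → Bool) → Sequent → Set
  Closes X Y q = Axiomatic q ⊎ Any (ClosedBy X Y q) (suc' q)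

  Closed : (X Y : State → Bool) → Sequent → Set
  Closed X Y q = Saturated (ant q) → Saturated (suc' q) → Closes X Y q

  closed? : ∀ X Y → Decidable (Closed X Y)
  closed? X Y q = saturated? (ant q) →-dec saturated? (suc' q) →-dec
                  (axiomatic? q ⊎-dec any? (closedBy? X Y q) (suc' q))

  ¬closed⇒open : ∀ {X Y q} → ¬ Closed X Y q → Saturated (ant q) × Saturated (suc' q) × ¬ Closes X Y q
  ¬closed⇒open {q = q} ¬closed with saturated? (ant q) | saturated? (suc' q)
  ... | yes satΓ | yes satΔ = satΓ , satΔ , λ closes → ¬closed λ _ _ → closes
  ... | no ¬satΓ | _ = ⊥-elim (¬closed λ satΓ → ⊥-elim (¬satΓ satΓ))
  ... | yes _ | no ¬satΔ = ⊥-elim (¬closed λ _ satΔ → ⊥-elim (¬satΔ satΔ))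

  -- The operator Fₐ of the proof idea: ν X a is its greatest fixed point in Y, and Provable
  -- the least fixed point of X ↦ ⋃ₐ ν X a.
  refine : (State → Bool) → Fin (length C) → (State → Bool) → State → Bool
  refine X a Y t = isYes (target t Fin.≟ a ×-dec all? (closed? X Y) (expansion (premise t)))

  νApprox : (State → Bool) → Fin (length C) → ℕ → State → Bool
  νApprox X a zero t = true
  νApprox X a (suc j) t = νApprox X a j t ∧ refine X a (νApprox X a j) t

  νStable : ∀ X a → ∃ λ j → νApprox X a j ⊆ᵇ νApprox X a (suc j)
  νStable X a = decreasing-chain-stabilises allStates ∈-allStates (νApprox X a)
    (λ j t → proj₁ ∘ Equivalence.to T-∧)

  ν : (State → Bool) → Fin (length C) → State → Bool
  ν X a = νApprox X a (proj₁ (νStable X a))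

  ν-post : ∀ X a t → T (ν X a t) → T (refine X a (ν X a) t)
  ν-post X a t = proj₂ ∘ Equivalence.to T-∧ ∘ proj₂ (νStable X a) t

  μApprox : ℕ → State → Bool
  μApprox zero t = false
  μApprox (suc k) t = μApprox k t ∨ ν (μApprox k) (target t) t

  μApprox-suc⁻ : ∀ k t → T (μApprox (suc k) t) → T (μApprox k t) ⊎ T (ν (μApprox k) (target t) t)
  μApprox-suc⁻ k t = Equivalence.to (T-∨ {μApprox k t})

  μApprox-sucˡ : ∀ k t → T (μApprox k t) → T (μApprox (suc k) t)
  μApprox-sucˡ k t = Equivalence.from (T-∨ {μApprox k t}) ∘ inj₁

  μApprox-sucʳ : ∀ k t → T (ν (μApprox k) (target t) t) → T (μApprox (suc k) t)
  μApprox-sucʳ k t = Equivalence.from (T-∨ {μApprox k t}) ∘ inj₂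

  μStable : ∃ λ k → μApprox (suc k) ⊆ᵇ μApprox k
  μStable = increasing-chain-stabilises allStates ∈-allStates μApprox μApprox-sucˡ

  bound : ℕ
  bound = proj₁ μStable

  Provable : State → Bool
  Provable = μApprox bound

  Provable-closed : ∀ t → T (ν Provable (target t) t) → T (Provable t)
  Provable-closed t = proj₂ μStable t ∘ μApprox-sucʳ bound t

  μApprox-mono : ∀ {j k} → j ≤ k → μApprox j ⊆ᵇ μApprox k
  μApprox-mono {k = zero} z≤n t = id
  μApprox-mono {k = suc k} j≤1+k t with m≤n⇒m<n∨m≡n j≤1+k
  ... | inj₁ (s≤s j≤k) = μApprox-sucˡ k t ∘ μApprox-mono j≤k t
  ... | inj₂ refl = id

  μApprox-least : ∀ {j k t} → ¬ T (μApprox j t) → T (μApprox k t) → j < k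
  μApprox-least ¬j∋t k∋t = ≰⇒> λ k≤j → ¬j∋t (μApprox-mono k≤j _ k∋t)

  record Entry (t : State) (k : ℕ) : Set where
    field
      stage  : ℕ
      early  : stage < k
      before : ¬ T (μApprox stage t)
      after  : T (μApprox (suc stage) t)

  entry : ∀ k {t} → T (μApprox k t) → Entry t k
  entry (suc k) {t} k+1∋t with T? (μApprox k t)
  ... | yes k∋t = let open Entry (entry k k∋t) in
    record { stage = stage ; early = m<n⇒m<1+n early ; before = before ; after = after }
  ... | no ¬k∋t = record { stage = k ; early = ≤-refl ; before = ¬k∋t ; after = k+1∋t }

  stageOf : ∀ {t} → T (Provable t) → ℕ
  stageOf p = Entry.stage (entry bound p)

-- Proofs from closing goals

unbox⁺ : Fm → Fm
unbox⁺ (□⁺ B) = B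
unbox⁺ _ = ⊥'

module Construction (C : List Fm) (C-unique : Unique C) (S₀ : Sequent) where
  open Search C

  -- As C has no duplicates, neither has □Σ, □⁺Π, so it can be split off Γ as a sub-multiset.
  modal-conclusion : ∀ {Γ Δ A} → A ∈ Δ → ∃ λ Υ → ∃ λ Λ → (Γ ⊢ Δ) ≅ (boxedContext Υ Γ ⊢ (A ∷ Λ))
  modal-conclusion {Γ} A∈Δ =
    let Υ , Γ↭ = ↭-extract boxes-unique (λ y∈ → [ boxed-⊆ □ Γ , boxed-⊆ □⁺ Γ ]′ (∈-++⁻ _ y∈))
        Λ , Δ↭ = ∈⇒↭∷ A∈Δ
    in Υ , Λ , Γ↭ , Δ↭
    where
    □≠□⁺ : Disjoint (map □ (select C (boxed □ Γ))) (map □⁺ (select C (boxed □⁺ Γ)))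
    □≠□⁺ (y∈□ , y∈□⁺) with _ , _ , refl ← ∈-map⁻ □ y∈□ with _ , _ , () ← ∈-map⁻ □⁺ y∈□⁺

    boxes-unique : Unique (map □ (select C (boxed □ Γ)) ++ map □⁺ (select C (boxed □⁺ Γ)))
    boxes-unique = Unique.++⁺ (Unique.map⁺ (λ { refl → refl }) (select-unique _ C-unique))
                              (Unique.map⁺ (λ { refl → refl }) (select-unique _ C-unique)) □≠□⁺

  data Origin : Set where
    goal      : Origin
    premiseOf : State → Origin

  start : Origin → Sequent
  start goal = S₀
  start (premiseOf t) = premise t

  ∅ : State → Bool
  ∅ _ = false

  ok : Origin → Bool
  ok goal = isYes (all? (closed? Provable ∅) (expansion S₀))
  ok (premiseOf t) = Provable t

  rank : ∀ o → T (ok o) → ℕ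
  rank goal _ = bound
  rank (premiseOf t) p = stageOf p

  -- The value ⊥' is never compared: only right premises of (□⁺) keep the rank of their node,
  -- and their target is □⁺ B.
  track : Origin → Fm
  track goal = ⊥'
  track (premiseOf t) = unbox⁺ (lookup C (target t))

  Index : Set
  Index = Σ Origin λ o → T (ok o) × Fin (length (expansion (start o)))

  label : Index → Sequent
  label (o , _ , k) = lookup (expansion (start o)) k

  rankᵢ : Index → ℕ
  rankᵢ (o , p , _) = rank o p

  trackᵢ : Index → Fm
  trackᵢ (o , _ , _) = track o

  record Level (o : Origin) (p : T (ok o)) : Set where
    field
      X Y       : State → Bool
      closed    : All (Closed X Y) (expansion (start o))
      X-lower   : ∀ t → T (X t) → Σ (T (Provable t)) λ p′ → stageOf p′ < rank o p
      Y-tracked : ∀ t → T (Y t) → Σ (T (Provable t)) λ p′ → stageOf p′ ≤ rank o p × track (premiseOf t) ≡ track o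

  level : ∀ o p → Level o p
  level goal p = record
    { X = Provable ; Y = ∅ ; closed = toWitness p
    ; X-lower = λ t p′ → p′ , Entry.early (entry bound p′)
    ; Y-tracked = λ _ () }
  level (premiseOf t) p = record
    { X = μApprox stage ; Y = ν (μApprox stage) (target t)
    ; closed = proj₂ (refined t ν∋t)
    ; X-lower = X-lower
    ; Y-tracked = Y-tracked }
    where
    open Entry (entry bound p)

    refined : ∀ t′ → T (ν (μApprox stage) (target t) t′) →
              target t′ ≡ target t × All (Closed (μApprox stage) (ν (μApprox stage) (target t))) (expansion (premise t′))
    refined t′ = toWitness ∘ ν-post (μApprox stage) (target t) t′

    ν∋t : T (ν (μApprox stage) (target t) t)
    ν∋t = [ ⊥-elim ∘ before , id ]′ (μApprox-suc⁻ stage t after)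

    X-lower : ∀ t′ → T (μApprox stage t′) → Σ (T (Provable t′)) λ p′ → stageOf p′ < stage
    X-lower t′ stage∋t′ = p′ , μApprox-least (Entry.before (entry bound p′)) stage∋t′
      where
      p′ : T (Provable t′)
      p′ = μApprox-mono (<⇒≤ early) t′ stage∋t′

    Y-tracked : ∀ t′ → T (ν (μApprox stage) (target t) t′) →
                Σ (T (Provable t′)) λ p′ → stageOf p′ ≤ stage × track (premiseOf t′) ≡ track (premiseOf t)
    Y-tracked t′ ν∋t′ =
      p′ , ≤-pred (μApprox-least {k = ℕ.suc stage} (Entry.before (entry bound p′)) stage+1∋t′)
         , cong (unbox⁺ ∘ lookup C) same-target
      where
      same-target : target t′ ≡ target t
      same-target = proj₁ (refined t′ ν∋t′)
      stage+1∋t′ : T (μApprox (ℕ.suc stage) t′)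
      stage+1∋t′ = μApprox-sucʳ stage t′ (subst (λ a → T (ν (μApprox stage) a t′)) (sym same-target) ν∋t′)
      p′ : T (Provable t′)
      p′ = μApprox-mono early t′ stage+1∋t′

  module Nodes (o : Origin) (p : T (ok o)) where
    open Level (level o p)

    NodeFor : Sequent → Set
    NodeFor q = RankedNode label rankᵢ trackᵢ (weight ∘ label) q (rank o p) (track o) (weight q)

    sibling : ∀ {q} → q ∈ expansion (start o) → Index
    sibling q∈ = o , p , index q∈

    sibling-label : ∀ {q} (q∈ : q ∈ expansion (start o)) → label (sibling q∈) ≡ q
    sibling-label q∈ = sym (lookup-index q∈)

    propositional : ∀ {q c} (s : Shape q) → (∀ {y} → y ∈ premises s → y ∈ expansion (start o)) →
                    (r : Inst c (premises s)) → q ≅ c → (∀ d → Tracks (track o) r d) → NodeFor q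
    propositional {q} s inExp r q≅c tracks = record
      { concl = _ ; prems = premises s ; inst = r ; concl≅ = q≅c
      ; child = λ d → sibling (inExp (∈-lookup d))
      ; child-label = λ d → sibling-label (inExp (∈-lookup d))
      ; rank-antitone = λ _ → ≤-refl
      ; rank-stable = λ d _ → tracks d , refl
      ; progress = λ d _ → inj₁ (subst (λ x → weight x < weight q) (sym (sibling-label (inExp (∈-lookup d))))
                                   (All.lookup (premises-lighter s) (∈-lookup d))) }

    leaf : ∀ {q c} → Inst c [] → q ≅ c → NodeFor q
    leaf r q≅c = record
      { concl = _ ; prems = [] ; inst = r ; concl≅ = q≅c ; child = λ () ; child-label = λ ()
      ; rank-antitone = λ () ; rank-stable = λ () ; progress = λ () }

    □-node : ∀ {Γ Δ} i Υ Λ → (Γ ⊢ Δ) ≅ (boxedContext Υ Γ ⊢ (□ (lookup C i) ∷ Λ)) →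
             T (X (stateAt (Γ ⊢ Δ) i)) → NodeFor (Γ ⊢ Δ)
    □-node {Γ} {Δ} i Υ Λ q≅ x = record
      { concl = _ ; prems = _
      ; inst = boxR Υ (select C (boxed □ Γ)) (select C (boxed □⁺ Γ)) Λ (lookup C i)
      ; concl≅ = q≅
      ; child = λ { zero → premiseOf t , p′ , zero }
      ; child-label = λ { zero → refl }
      ; rank-antitone = λ { zero → <⇒≤ lower }
      ; rank-stable = λ { zero eq → ⊥-elim (<-irrefl eq lower) }
      ; progress = λ { zero _ → inj₂ lower } }
      where
      t : State
      t = stateAt (Γ ⊢ Δ) i
      p′ : T (Provable t)
      p′ = proj₁ (X-lower t x)
      lower : stageOf p′ < rank o p
      lower = proj₂ (X-lower t x)

    □⁺-node : ∀ {Γ Δ} i j Υ Λ → (Γ ⊢ Δ) ≅ (boxedContext Υ Γ ⊢ (□⁺ (lookup C i) ∷ Λ)) →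
              lookup C j ≡ □⁺ (lookup C i) →
              T (X (stateAt (Γ ⊢ Δ) i)) → T (X (stateAt (Γ ⊢ Δ) j)) ⊎ T (Y (stateAt (Γ ⊢ Δ) j)) →
              NodeFor (Γ ⊢ Δ)
    □⁺-node {Γ} {Δ} i j Υ Λ q≅ j↦□⁺B x xy = record
      { concl = _ ; prems = _
      ; inst = box⁺R Υ (select C (boxed □ Γ)) (select C (boxed □⁺ Γ)) Λ (lookup C i)
      ; concl≅ = q≅
      ; child = λ { zero → premiseOf tₗ , pₗ , zero ; (suc zero) → premiseOf tᵣ , proj₁ right , zero }
      ; child-label = λ { zero → refl ; (suc zero) → cong (modalPremise _ _) j↦□⁺B }
      ; rank-antitone = λ { zero → <⇒≤ lowerₗ ; (suc zero) → proj₁ (proj₂ right) }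
      ; rank-stable = λ { zero eq → ⊥-elim (<-irrefl eq lowerₗ)
                        ; (suc zero) eq → let tr , tr′ = proj₂ (proj₂ right) eq in (tr , refl) , tr′ }
      ; progress = λ { _ ¬□⁺ → ⊥-elim (¬□⁺ tt) } }
      where
      tₗ tᵣ : State
      tₗ = stateAt (Γ ⊢ Δ) i
      tᵣ = stateAt (Γ ⊢ Δ) j
      pₗ : T (Provable tₗ)
      pₗ = proj₁ (X-lower tₗ x)
      lowerₗ : stageOf pₗ < rank o p
      lowerₗ = proj₂ (X-lower tₗ x)

      RightPremise : Set
      RightPremise = Σ (T (Provable tᵣ)) λ pᵣ → stageOf pᵣ ≤ rank o p ×
                     (stageOf pᵣ ≡ rank o p → lookup C i ≡ track o × track (premiseOf tᵣ) ≡ track o)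

      -- A right premise of the same rank comes from Y, whose target is □⁺ of the tracked formula.
      right : RightPremise
      right = [ fromX , fromY ]′ xy
        where
        fromX : T (X tᵣ) → RightPremise
        fromX xᵣ = let pᵣ , lt = X-lower tᵣ xᵣ in pᵣ , <⇒≤ lt , λ eq → ⊥-elim (<-irrefl eq lt)
        fromY : T (Y tᵣ) → RightPremise
        fromY yᵣ = let pᵣ , le , tr = Y-tracked tᵣ yᵣ in
          pᵣ , le , λ _ → trans (sym (cong unbox⁺ j↦□⁺B)) tr , tr

    closingNode : ∀ {q} → Closes X Y q → NodeFor q
    closingNode {Γ ⊢ Δ} (inj₁ (inj₁ ⊥∈Γ)) = let R , Γ↭ = ∈⇒↭∷ ⊥∈Γ in leaf (ax⊥ R Δ) (Γ↭ , ↭-refl)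
    closingNode {Γ ⊢ Δ} (inj₁ (inj₂ shared)) with var n , v∈Γ , is-var , v∈Δ ← find shared =
      let R , Γ↭ = ∈⇒↭∷ v∈Γ ; R′ , Δ↭ = ∈⇒↭∷ v∈Δ in leaf (axVar R R′ n) (Γ↭ , Δ↭)
    closingNode {Γ ⊢ Δ} (inj₂ closes) with find closes
    ... | _ , □B∈Δ , by-□ i refl x =
      let Υ , Λ , q≅ = modal-conclusion {Γ} □B∈Δ in □-node i Υ Λ q≅ x
    ... | _ , □⁺B∈Δ , by-□⁺ i j refl j↦□⁺B x xy =
      let Υ , Λ , q≅ = modal-conclusion {Γ} □⁺B∈Δ in □⁺-node i j Υ Λ q≅ j↦□⁺B x xy

    shapeNode : ∀ {q} (s : Shape q) → (∀ {y} → y ∈ premises s → y ∈ expansion (start o)) → Closed X Y q → NodeFor q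
    shapeNode s@(⇒L-shape P A B R Δ) inExp _ = propositional s inExp (⇒L (P ++ R) Δ A B) (shift _ P R , ↭-refl) _
    shapeNode s@(⇒R-shape Γ P A B R) inExp _ = propositional s inExp (⇒R Γ (P ++ R) A B) (↭-refl , shift _ P R) _
    shapeNode (saturated satΓ satΔ) _ closed = closingNode (closed satΓ satΔ)

    nodeAt : ∀ {q} → q ∈ expansion (start o) → NodeFor q
    nodeAt {q} q∈ = shapeNode (shape q) (expansion-closed q∈) (All.lookup closed q∈)

  origins : List Origin
  origins = goal ∷ map premiseOf allStates

  ∈-origins : ∀ o → o ∈ origins
  ∈-origins goal = here refl
  ∈-origins (premiseOf t) = there (∈-map⁺ premiseOf (∈-allStates t))

  indicesAt : Origin → List Index
  indicesAt o with T? (ok o)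
  ... | yes p = map (λ k → o , p , k) (allFin _)
  ... | no _ = []

  ∈-indicesAt : ∀ o p k → (o , p , k) ∈ indicesAt o
  ∈-indicesAt o p k with T? (ok o)
  ... | yes p′ rewrite T-irrelevant p p′ = ∈-map⁺ (λ k → o , p′ , k) (∈-allFin k)
  ... | no ¬p = ⊥-elim (¬p p)

  indices : List Index
  indices = concatMap indicesAt origins

  ∈-indices : ∀ i → i ∈ indices
  ∈-indices (o , p , k) = ∈-concatMap⁺ indicesAt (lose (∈-origins o) (∈-indicesAt o p k))

  goal-regProvable : T (ok goal) → RegProvable S₀
  goal-regProvable p = ranked⇒regProvable label rankᵢ trackᵢ (weight ∘ label) indices ∈-indices
    (λ (o , p , k) → Nodes.nodeAt o p (∈-lookup k)) (goal , p , zero)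

-- Countermodels from open goals

module Countermodel (C : List Fm) (C-closed : SubformulaClosed C) where
  open Search C
  open Closure C-closed

  premise-over : ∀ q i → Over C q → Over C (premise (stateAt q i))
  premise-over q i (Γ⊆ , _) = Σ⊆ , λ { (here refl) → ∈-lookup i }
    where
    Σ⊆ : ant (premise (stateAt q i)) ⊆ C
    Σ⊆ y∈ with ∈-++⁻ (select C _) y∈
    ... | inj₁ y∈Σ = select-⊆ C _ y∈Σ
    ... | inj₂ y∈ with ∈-++⁻ (select C _) y∈
    ...   | inj₁ y∈Π = select-⊆ C _ y∈Π
    ...   | inj₂ y∈□⁺Π = Γ⊆ (boxed-⊆ □⁺ (ant q) y∈□⁺Π)

  □-premise : ∀ q {B} i → B ∈ C → □ B ∈ ant q → B ∈ ant (premise (stateAt q i))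
  □-premise q i B∈C □B∈ with k , refl ← ∈⇒lookup B∈C = ∈-++⁺ˡ (boxed-∈ □ (ant q) k □B∈)

  □⁺-premise : ∀ q {B} i → B ∈ C → □⁺ B ∈ ant q →
               B ∈ ant (premise (stateAt q i)) × □⁺ B ∈ ant (premise (stateAt q i))
  □⁺-premise q i B∈C □⁺B∈ with k , refl ← ∈⇒lookup B∈C =
    ∈-++⁺ʳ (select C _) (∈-++⁺ˡ B∈Π) , ∈-++⁺ʳ (select C _) (∈-++⁺ʳ (select C _) (∈-map⁺ □⁺ B∈Π))
    where
    B∈Π : lookup C k ∈ select C (boxed □⁺ (ant q))
    B∈Π = boxed-∈ □⁺ (ant q) k □⁺B∈

  record World : Set where
    field
      root leaf : Sequent
      over      : Over C root
      path      : root ⟶* leaf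
      satΓ      : Saturated (ant leaf)
      satΔ      : Saturated (suc' leaf)
      ¬axiom    : ¬ Axiomatic leaf
      ¬□        : ∀ {B} i → lookup C i ≡ B → □ B ∈ suc' leaf → ¬ T (Provable (stateAt leaf i))
      ¬□⁺       : ∀ {B} i j → lookup C i ≡ B → lookup C j ≡ □⁺ B → □⁺ B ∈ suc' leaf →
                  T (Provable (stateAt leaf i)) → ¬ T (Provable (stateAt leaf j))

    leaf-over : Over C leaf
    leaf-over = ⟶*-over C-closed path over

  open World

  world : ∀ {s x Y} → Over C s → x ∈ expansion s → ¬ Closed Provable Y x → World
  world {s} {x} ov x∈ ¬closed with sat-ant , sat-suc , ¬closes ← ¬closed⇒open ¬closed = record
    { root = s ; leaf = x ; over = ov ; path = ∈-expansion⇒⟶* x∈ ; satΓ = sat-ant ; satΔ = sat-suc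
    ; ¬axiom = ¬closes ∘ inj₁
    ; ¬□ = λ i eq □B∈ p → ¬closes (inj₂ (lose □B∈ (by-□ i eq p)))
    ; ¬□⁺ = λ i j eq eq′ □⁺B∈ p p′ → ¬closes (inj₂ (lose □⁺B∈ (by-□⁺ i j eq eq′ p (inj₁ p′)))) }

  _R_ : World → World → Set
  w R v = ∃ λ i → root v ≡ premise (stateAt (leaf w) i)

  target∈root : ∀ v t {B} → root v ≡ premise t → lookup C (target t) ≡ B → B ∈ suc' (root v)
  target∈root _ (_ , _ , _) root≡ i↦ = subst (λ s → _ ∈ suc' s) (sym root≡) (here (sym i↦))

  valuation : World → ℕ → Bool
  valuation w n = isYes (var n ∈? ant (leaf w))

  open Kripke _R_ valuation

  failing-leaf : ∀ X a j {t} → T (νApprox X a j t) → ¬ T (νApprox X a (suc j) t) → target t ≡ a →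
                 ∃ λ x → x ∈ expansion (premise t) × ¬ Closed X (νApprox X a j) x
  failing-leaf X a j {t} j∋t ¬j+1∋t refl =
    let x , x∈ , ¬closed = find (¬All⇒Any¬ (closed? X (νApprox X a j)) _ ¬all) in x , x∈ , ¬closed
    where
    ¬all : ¬ All (Closed X (νApprox X a j)) (expansion (premise t))
    ¬all all = ¬j+1∋t (Equivalence.from T-∧ (j∋t , fromWitness (refl , all)))

  world-at : ∀ t → ¬ T (Provable t) → Over C (premise t) → Σ World λ v → root v ≡ premise t
  world-at t ¬p ov = descend (proj₁ (νStable Provable (target t))) (¬p ∘ Provable-closed t)
    where
    descend : ∀ j → ¬ T (νApprox Provable (target t) j t) → Σ World λ v → root v ≡ premise t
    descend zero ¬top = ⊥-elim (¬top tt)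
    descend (suc j) ¬j+1∋t = step (T? (νApprox Provable (target t) j t))
      where
      step : Dec (T (νApprox Provable (target t) j t)) → Σ World λ v → root v ≡ premise t
      step (no ¬j∋t) = descend j ¬j∋t
      step (yes j∋t) = let _ , x∈ , ¬closed = failing-leaf Provable (target t) j j∋t ¬j+1∋t refl in world ov x∈ ¬closed , refl

  -- Refuting □⁺ B: follow the right premises whose states fail ν, until a left premise fails.
  □⁺-refuter : ∀ B → (∀ v → B ∈ suc' (root v) → ¬ v ⊨ B) → ∀ {a} → lookup C a ≡ □⁺ B →
               ∀ j t → target t ≡ a → ¬ T (νApprox Provable a j t) → Over C (premise t) →
               Σ World λ v → root v ≡ premise t × ∃ λ u → Star _R_ v u × ¬ u ⊨ B
  □⁺-refuter B ih a↦ zero t _ ¬top _ = ⊥-elim (¬top tt)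
  □⁺-refuter B ih {a} a↦ (suc j) t refl ¬j+1∋t ov = step (T? (νApprox Provable a j t))
    where
    Result : Set
    Result = Σ World λ v → root v ≡ premise t × ∃ λ u → Star _R_ v u × ¬ u ⊨ B

    step : Dec (T (νApprox Provable a j t)) → Result
    step (no ¬j∋t) = □⁺-refuter B ih a↦ j t refl ¬j∋t ov
    step (yes j∋t) = fromLeaf (failing-leaf Provable a j j∋t ¬j+1∋t refl)
      where
      fromLeaf : (∃ λ x → x ∈ expansion (premise t) × ¬ Closed Provable (νApprox Provable a j) x) → Result
      fromLeaf (x , x∈ , ¬closed) = leftOrRight (T? (Provable (stateAt x i)))
        where
        v : World
        v = world ov x∈ ¬closed
        x-over : Over C x
        x-over = leaf-over v
        □⁺B∈Δ : □⁺ B ∈ suc' x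
        □⁺B∈Δ = proj₂ (⟶*-keeps (path v) (λ ())) (here (sym a↦))
        i : Fin (length C)
        i = proj₁ (∈⇒lookup (□⁺-closed (proj₂ x-over □⁺B∈Δ)))
        i↦ : lookup C i ≡ B
        i↦ = proj₂ (∈⇒lookup (□⁺-closed (proj₂ x-over □⁺B∈Δ)))
        ¬closes : ¬ Closes Provable (νApprox Provable a j) x
        ¬closes = proj₂ (proj₂ (¬closed⇒open ¬closed))

        leftOrRight : Dec (T (Provable (stateAt x i))) → Result
        leftOrRight (no ¬p) =
          let u , root≡ = world-at (stateAt x i) ¬p (premise-over x i x-over) in
          v , refl , u , (i , root≡) ◅ ε , ih u (target∈root u (stateAt x i) root≡ i↦)
        leftOrRight (yes p) =
          let v′ , root≡ , u , v′R*u , ¬u⊨B = □⁺-refuter B ih a↦ j (stateAt x a) refl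
                (λ ν∋ → ¬closes (inj₂ (lose □⁺B∈Δ (by-□⁺ i a i↦ a↦ p (inj₂ ν∋)))))
                (premise-over x a x-over) in
          v , refl , u , (a , root≡) ◅ v′R*u , ¬u⊨B

  record Truth (A : Fm) (w : World) (x : Sequent) : Set where
    constructor _,_
    field
      ant⊨ : A ∈ ant x → w ⊨ A
      suc⊭ : A ∈ suc' x → ¬ w ⊨ A

  open Truth

  kept : ∀ {A w x y} → Keeps A x y → Truth A w y → Truth A w x
  kept (ka , ks) (ta , ts) = ta ∘ ka , ts ∘ ks

  ⇒-truth : ∀ {A₁ A₂ w x y} (s : Shape x) → y ∈ premises s →
            Truth A₁ w y → Truth A₂ w y → Truth (A₁ ⇒ A₂) w y → Truth (A₁ ⇒ A₂) w x
  ⇒-truth (⇒L-shape P A B R Δ) (here refl) _ (B⊨ , _) (ta , ts) = ta′ , ts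
    where
    ta′ : _ ∈ P ++ (A ⇒ B) ∷ R → _
    ta′ A⇒∈ with ∈-++∷⁻ P A⇒∈
    ... | inj₁ refl = λ _ → B⊨ (here refl)
    ... | inj₂ A⇒∈′ = ta (there A⇒∈′)
  ⇒-truth (⇒L-shape P A B R Δ) (there (here refl)) (_ , A⊭) _ (ta , ts) = ta′ , ts ∘ there
    where
    ta′ : _ ∈ P ++ (A ⇒ B) ∷ R → _
    ta′ A⇒∈ with ∈-++∷⁻ P A⇒∈
    ... | inj₁ refl = ⊥-elim ∘ A⊭ (here refl)
    ... | inj₂ A⇒∈′ = ta A⇒∈′
  ⇒-truth (⇒R-shape Γ P A B R) (here refl) (A⊨ , _) (_ , B⊭) (ta , ts) = ta ∘ there , ts′
    where
    ts′ : _ ∈ P ++ (A ⇒ B) ∷ R → _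
    ts′ A⇒∈ with ∈-++∷⁻ P A⇒∈
    ... | inj₁ refl = λ f → B⊭ (here refl) (f (A⊨ (here refl)))
    ... | inj₂ A⇒∈′ = ts (there A⇒∈′)

  mutual
    truth : ∀ A w {x} → x ⟶* leaf w → Truth A w x
    truth A w ε = truth-leaf A w
    truth (A₁ ⇒ A₂) w {x} (x⟶y ◅ path) =
      ⇒-truth (shape x) x⟶y (truth A₁ w path) (truth A₂ w path) (truth (A₁ ⇒ A₂) w path)
    truth (var n) w {x} (x⟶y ◅ path) = kept (⟶-keeps {x} x⟶y λ ()) (truth (var n) w path)
    truth ⊥' w {x} (x⟶y ◅ path) = kept (⟶-keeps {x} x⟶y λ ()) (truth ⊥' w path)
    truth (□ B) w {x} (x⟶y ◅ path) = kept (⟶-keeps {x} x⟶y λ ()) (truth (□ B) w path)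
    truth (□⁺ B) w {x} (x⟶y ◅ path) = kept (⟶-keeps {x} x⟶y λ ()) (truth (□⁺ B) w path)

    truth-root : ∀ A v → Truth A v (root v)
    truth-root A v = truth A v (path v)

    truth-leaf : ∀ A w → Truth A w (leaf w)
    truth-leaf (var n) w = fromWitness , λ v∈Δ v⊨ → ¬axiom w (inj₂ (lose (toWitness v⊨) (is-var , v∈Δ)))
    truth-leaf ⊥' w = (λ ⊥∈Γ → ⊥-elim (¬axiom w (inj₁ ⊥∈Γ))) , λ _ → id
    truth-leaf (A₁ ⇒ A₂) w = ⊥-elim ∘ saturated-∌⇒ (satΓ w) , ⊥-elim ∘ saturated-∌⇒ (satΔ w)
    truth-leaf (□ B) w = □-antecedent , □-succedent
      where
      □-antecedent : □ B ∈ ant (leaf w) → w ⊨ □ B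
      □-antecedent □B∈ {v} (i , root≡) = ant⊨ (truth-root B v)
        (subst (λ s → B ∈ ant s) (sym root≡) (□-premise (leaf w) i (□-closed (proj₁ (leaf-over w) □B∈)) □B∈))

      □-succedent : □ B ∈ suc' (leaf w) → ¬ w ⊨ □ B
      □-succedent □B∈ w⊨□B =
        let i , i↦ = ∈⇒lookup (□-closed (proj₂ (leaf-over w) □B∈))
            v , root≡ = world-at (stateAt (leaf w) i) (¬□ w i i↦ □B∈) (premise-over _ i (leaf-over w))
        in suc⊭ (truth-root B v) (target∈root v (stateAt (leaf w) i) root≡ i↦) (w⊨□B (i , root≡))
    truth-leaf (□⁺ B) w = □⁺-antecedent w , □⁺-succedent
      where
      □⁺-antecedent : ∀ u → □⁺ B ∈ ant (leaf u) → u ⊨ □⁺ B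
      □⁺-antecedent u □⁺B∈ {v} [ i , root≡ ]⁺ = ant⊨ (truth-root B v)
        (subst (λ s → B ∈ ant s) (sym root≡) (proj₁ (□⁺-premise (leaf u) i B∈C □⁺B∈)))
        where
        B∈C : B ∈ C
        B∈C = □⁺-closed (proj₁ (leaf-over u) □⁺B∈)
      □⁺-antecedent u □⁺B∈ (_∷_ {y = m} (i , root≡) mR⁺) = □⁺-antecedent m
        (proj₁ (⟶*-keeps (path m) (λ ()))
          (subst (λ s → □⁺ B ∈ ant s) (sym root≡) (proj₂ (□⁺-premise (leaf u) i B∈C □⁺B∈))))
        mR⁺
        where
        B∈C : B ∈ C
        B∈C = □⁺-closed (proj₁ (leaf-over u) □⁺B∈)

      □⁺-succedent : □⁺ B ∈ suc' (leaf w) → ¬ w ⊨ □⁺ B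
      □⁺-succedent □⁺B∈ w⊨□⁺B = leftOrRight (T? (Provable (stateAt (leaf w) i)))
        where
        i a : Fin (length C)
        i = proj₁ (∈⇒lookup (□⁺-closed (proj₂ (leaf-over w) □⁺B∈)))
        a = proj₁ (∈⇒lookup (proj₂ (leaf-over w) □⁺B∈))
        i↦ : lookup C i ≡ B
        i↦ = proj₂ (∈⇒lookup (□⁺-closed (proj₂ (leaf-over w) □⁺B∈)))
        a↦ : lookup C a ≡ □⁺ B
        a↦ = proj₂ (∈⇒lookup (proj₂ (leaf-over w) □⁺B∈))

        leftOrRight : Dec (T (Provable (stateAt (leaf w) i))) → ⊥
        leftOrRight (no ¬p) =
          let v , root≡ = world-at (stateAt (leaf w) i) ¬p (premise-over _ i (leaf-over w)) in
          suc⊭ (truth-root B v) (target∈root v (stateAt (leaf w) i) root≡ i↦) (w⊨□⁺B [ i , root≡ ]⁺)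
        leftOrRight (yes p) =
          let v , root≡ , u , vR*u , ¬u⊨B = □⁺-refuter B (λ v → suc⊭ (truth-root B v)) a↦
                (proj₁ (νStable Provable a)) (stateAt (leaf w) a) refl
                (¬□⁺ w i a i↦ a↦ □⁺B∈ p ∘ Provable-closed _)
                (premise-over _ a (leaf-over w))
          in ¬u⊨B (w⊨□⁺B (◅⁺ (a , root≡) vR*u))

  refuted : ∀ {Γ Δ Y} → Over C (Γ ⊢ Δ) → ¬ All (Closed Provable Y) (expansion (Γ ⊢ Δ)) → ¬ K⁺⊢ (⋀ Γ ⇒ ⋁ Δ)
  refuted {Y = Y} over ¬all ⊢Γ⇒Δ with x , x∈ , ¬closed ← find (¬All⇒Any¬ (closed? Provable Y) _ ¬all) =
    no-countermodel ⊢Γ⇒Δ (λ {A} → ant⊨ (truth-root A w)) (λ {A} → suc⊭ (truth-root A w))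
    where
    w : World
    w = world over x∈ ¬closed

mainTheorem3 : (Γ Δ : List Fm) → K⁺⊢ (⋀ Γ ⇒ ⋁ Δ) → RegProvable (Γ ⊢ Δ)
mainTheorem3 Γ Δ ⊢Γ⇒Δ = decide (T? (ok goal))
  where
  C : List Fm
  C = subformulaClosure (Γ ++ Δ)

  open Construction C (deduplicate-! _) (Γ ⊢ Δ) using (ok; goal; goal-regProvable)
  open Countermodel C (subformulaClosure-closed (Γ ++ Δ)) using (refuted)

  over : Over C (Γ ⊢ Δ)
  over = subformulaClosure-⊇ _ ∘ ∈-++⁺ˡ , subformulaClosure-⊇ _ ∘ ∈-++⁺ʳ Γ

  decide : Dec (T (ok goal)) → RegProvable (Γ ⊢ Δ)
  decide (yes p) = goal-regProvable p
  decide (no ¬p) = ⊥-elim (refuted over (¬p ∘ fromWitness) ⊢Γ⇒Δ)
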